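{- For every set of names $\rho$ and processes $P,Q$: if $\rho\vdash P$ and $P\equiv Q$, then $\rho\vdash Q$.
   Context: Processes: $P,Q ::= 0 \mid P \mid Q \mid (\nu a)P \mid (a)P \mid \alpha.P$, with prefixes $\alpha ::= \overline{a}\langle b\rangle$ (output) $\mid a(x)$ (input, binding $x$) $\mid \overline{a}\{b\}$ (send authorization for $b$ on $a$) $\mid a\{b\}$ (receive authorization for $b$ on $a$). $(a)P$ is the authorization scope; it does not bind $a$, and in $a\{b\}.P$ the name $b$ is not bound. Only $(\nu a)$ and input bind names. Free names: $\mathrm{fn}((a)P)=\{a\}\cup\mathrm{fn}(P)$, $\mathrm{fn}(\overline{a}\{b\}.P)=\mathrm{fn}(a\{b\}.P)=\{a,b\}\cup\mathrm{fn}(P)$, as usual for the $\pi$-calculus otherwise. Structural congruence $\equiv$ is the least congruence satisfying: $P\mid 0\equiv P$; $P\mid Q\equiv Q\mid P$; $(P\mid Q)\mid R\equiv P\mid(Q\mid R)$; $(\nu a)0\equiv 0$; $(\nu a)(\nu b)P\equiv(\nu b)(\nu a)P$; $P\mid(\nu a)Q\equiv(\nu a)(P\mid Q)$ if $a\notin\mathrm{fn}(P)$; $\alpha$-equivalent processes are congruent; $(a)(b)P\equiv(b)(a)P$; $(a)0\equiv 0$; $(a)(P\mid Q)\equiv(a)P\mid(a)Q$; $(a)(\nu b)P\equiv(\nu b)(a)P$ if $a\neq b$. Typing: $\rho$ is a set of names; $\rho\vdash P$ is the least relation closed under: $\emptyset\vdash 0$; from $\rho_1\vdash P$, $\rho_2\vdash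 Q$ infer $\rho_1\cup\rho_2\vdash P\mid Q$; from $\rho\vdash P$, $a\notin\rho$ infer $\rho\vdash(\nu a)P$; from $\rho\vdash P$ infer $\rho\setminus\{a\}\vdash(a)P$; from $\rho\vdash P$ infer $\rho\cup\{a\}\vdash\overline{a}\langle b\rangle.P$; from $\rho\vdash P$, $x\notin\rho$ infer $\rho\cup\{a\}\vdash a(x).P$; from $\rho\vdash P$, $b\notin\rho$ infer $\rho\cup\{a,b\}\vdash\overline{a}\{b\}.P$; from $\rho\vdash P$ infer $(\rho\setminus\{b\})\cup\{a\}\vdash a\{b\}.P$. -}

module Defs where

open import Data.Nat using (ℕ; _≟_)
open import Data.Empty using (⊥)
open import Data.Sum using (_⊎_)
open import Data.Product using (_×_)
open import Relation.Nullary using (¬_; yes; no)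
open import Relation.Binary.PropositionalEquality using (_≡_)
open import Function.Bundles using (_⇔_)

Name : Set
Name = ℕ

data Prefix : Set where
  out   : Name → Name → Prefix
  inp   : Name → Name → Prefix   -- a(x), binds x
  sauth : Name → Name → Prefix
  rauth : Name → Name → Prefix

infixr 6 _∙_
infixl 5 _∥_
data Proc : Set where
  𝟘    : Proc
  _∥_  : Proc → Proc → Proc
  ν    : Name → Proc → Proc     -- (ν a) P, binds a
  auth : Name → Proc → Proc     -- (a) P, authorization scope, not binding
  _∙_  : Prefix → Proc → Proc

NameSet : Set₁
NameSet = Name → Set

∅ : NameSet
∅ _ = ⊥

⁅_⁆ : Name → NameSet
⁅ a ⁆ x = x ≡ a

_∪_ : NameSet → NameSet → NameSet
(A ∪ B) x = A x ⊎ B x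

_∖_ : NameSet → Name → NameSet
(A ∖ a) x = A x × ¬ (x ≡ a)

_≐_ : NameSet → NameSet → Set
A ≐ B = ∀ x → A x ⇔ B x

fn : Proc → NameSet
fn 𝟘 = ∅
fn (P ∥ Q) = fn P ∪ fn Q
fn (ν a P) = fn P ∖ a
fn (auth a P) = ⁅ a ⁆ ∪ fn P
fn (out a b ∙ P) = (⁅ a ⁆ ∪ ⁅ b ⁆) ∪ fn P
fn (inp a x ∙ P) = ⁅ a ⁆ ∪ (fn P ∖ x)
fn (sauth a b ∙ P) = (⁅ a ⁆ ∪ ⁅ b ⁆) ∪ fn P
fn (rauth a b ∙ P) = (⁅ a ⁆ ∪ ⁅ b ⁆) ∪ fn P

swapN : Name → Name → Name → Name
swapN a b c with c ≟ a
... | yes _ = b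
... | no _ with c ≟ b
...   | yes _ = a
...   | no _ = c

swapα : Name → Name → Prefix → Prefix
swapα a b (out c d)   = out (swapN a b c) (swapN a b d)
swapα a b (inp c d)   = inp (swapN a b c) (swapN a b d)
swapα a b (sauth c d) = sauth (swapN a b c) (swapN a b d)
swapα a b (rauth c d) = rauth (swapN a b c) (swapN a b d)

swap : Name → Name → Proc → Proc
swap a b 𝟘 = 𝟘
swap a b (P ∥ Q) = swap a b P ∥ swap a b Q
swap a b (ν c P) = ν (swapN a b c) (swap a b P)
swap a b (auth c P) = auth (swapN a b c) (swap a b P)
swap a b (α ∙ P) = swapα a b α ∙ swap a b P

-- Structural congruence: the least congruence containing the axioms.
-- α-equivalence is generated by renaming a single binder to a name that
-- is not free in its scope (renaming done by swapping; since the new name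
-- is not free in the body, this coincides with capture-avoiding
-- substitution up to α).
infix 4 _≅_
data _≅_ : Proc → Proc → Set where
  ≅-refl  : ∀ {P} → P ≅ P
  ≅-sym   : ∀ {P Q} → P ≅ Q → Q ≅ P
  ≅-trans : ∀ {P Q R} → P ≅ Q → Q ≅ R → P ≅ R
  ≅-par   : ∀ {P P' Q Q'} → P ≅ P' → Q ≅ Q' → P ∥ Q ≅ P' ∥ Q'
  ≅-ν     : ∀ {a P P'} → P ≅ P' → ν a P ≅ ν a P'
  ≅-auth  : ∀ {a P P'} → P ≅ P' → auth a P ≅ auth a P'
  ≅-pre   : ∀ {α P P'} → P ≅ P' → α ∙ P ≅ α ∙ P'
  par-unit  : ∀ {P} → P ∥ 𝟘 ≅ P
  par-comm  : ∀ {P Q} → P ∥ Q ≅ Q ∥ P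
  par-assoc : ∀ {P Q R} → (P ∥ Q) ∥ R ≅ P ∥ (Q ∥ R)
  ν-zero    : ∀ {a} → ν a 𝟘 ≅ 𝟘
  ν-swap    : ∀ {a b P} → ν a (ν b P) ≅ ν b (ν a P)
  ν-extr    : ∀ {a P Q} → ¬ fn P a → P ∥ ν a Q ≅ ν a (P ∥ Q)
  α-ν       : ∀ {a b P} → ¬ fn (ν a P) b → ν a P ≅ ν b (swap a b P)
  α-inp     : ∀ {c x y P} → ¬ fn (ν x P) y →
              inp c x ∙ P ≅ inp c y ∙ swap x y P
  auth-swap : ∀ {a b P} → auth a (auth b P) ≅ auth b (auth a P)
  auth-zero : ∀ {a} → auth a 𝟘 ≅ 𝟘
  auth-par  : ∀ {a P Q} → auth a (P ∥ Q) ≅ auth a P ∥ auth a Q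
  auth-ν    : ∀ {a b P} → ¬ (a ≡ b) → auth a (ν b P) ≅ ν b (auth a P)

-- Typing ρ ⊢ P: the least relation closed under the rules, where ρ ranges
-- over sets of names (so the index of each conclusion is taken up to
-- extensional set equality ≐).
infix 3 _⊢_
data _⊢_ : NameSet → Proc → Set₁ where
  t-zero  : ∀ {ρ} → ρ ≐ ∅ → ρ ⊢ 𝟘
  t-par   : ∀ {ρ ρ₁ ρ₂ P Q} → ρ₁ ⊢ P → ρ₂ ⊢ Q → ρ ≐ (ρ₁ ∪ ρ₂) → ρ ⊢ P ∥ Q
  t-ν     : ∀ {ρ a P} → ρ ⊢ P → ¬ ρ a → ρ ⊢ ν a P
  t-auth  : ∀ {ρ ρ' a P} → ρ' ⊢ P → ρ ≐ (ρ' ∖ a) → ρ ⊢ auth a P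
  t-out   : ∀ {ρ ρ' a b P} → ρ' ⊢ P → ρ ≐ (ρ' ∪ ⁅ a ⁆) → ρ ⊢ out a b ∙ P
  t-inp   : ∀ {ρ ρ' a x P} → ρ' ⊢ P → ¬ ρ' x → ρ ≐ (ρ' ∪ ⁅ a ⁆) → ρ ⊢ inp a x ∙ P
  t-sauth : ∀ {ρ ρ' a b P} → ρ' ⊢ P → ¬ ρ' b →
            ρ ≐ ((ρ' ∪ ⁅ a ⁆) ∪ ⁅ b ⁆) → ρ ⊢ sauth a b ∙ P
  t-rauth : ∀ {ρ ρ' a b P} → ρ' ⊢ P → ρ ≐ ((ρ' ∖ b) ∪ ⁅ a ⁆) → ρ ⊢ rauth a b ∙ P

-- We prove the stronger, symmetric fact that structurally congruent
-- processes are "typing-equivalent", i.e. have exactly the same typings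
-- ρ ⊢ _.  Since typing equivalence is an equivalence relation, it suffices
-- to show that it is a congruence for every process constructor and that
-- each axiom of ≅ relates typing-equivalent processes.

module Submission where

open import Defs
open import Data.Nat using (_≟_)
open import Data.Empty using (⊥-elim)
open import Data.Sum using (inj₁; inj₂; [_,_])
open import Data.Product using (_×_; _,_; proj₁)
open import Relation.Nullary using (¬_; Dec; yes; no)
open import Relation.Binary.PropositionalEquality
  using (_≡_; refl; sym; trans; cong; cong₂; subst; module ≡-Reasoning)
open import Function.Bundles using (mk⇔; Equivalence)

module _ {A B : NameSet} where

  mk≐ : (∀ c → A c → B c) → (∀ c → B c → A c) → A ≐ B
  mk≐ f g c = mk⇔ (f c) (g c)

  ≐-to : A ≐ B → ∀ c → A c → B c
  ≐-to e c = Equivalence.to (e c)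

  ≐-from : A ≐ B → ∀ c → B c → A c
  ≐-from e c = Equivalence.from (e c)

≐-refl : ∀ {A} → A ≐ A
≐-refl = mk≐ (λ _ r → r) (λ _ r → r)

≐-sym : ∀ {A B} → A ≐ B → B ≐ A
≐-sym e = mk≐ (≐-from e) (≐-to e)

≐-trans : ∀ {A B C} → A ≐ B → B ≐ C → A ≐ C
≐-trans e₁ e₂ =
  mk≐ (λ c r → ≐-to e₂ c (≐-to e₁ c r)) (λ c r → ≐-from e₁ c (≐-from e₂ c r))

∪-cong : ∀ {A A′ B B′} → A ≐ A′ → B ≐ B′ → (A ∪ B) ≐ (A′ ∪ B′)
∪-cong e₁ e₂ =
  mk≐ (λ c → [ (λ r → inj₁ (≐-to e₁ c r))   , (λ r → inj₂ (≐-to e₂ c r)) ])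
      (λ c → [ (λ r → inj₁ (≐-from e₁ c r)) , (λ r → inj₂ (≐-from e₂ c r)) ])

∖-cong : ∀ {A B a} → A ≐ B → (A ∖ a) ≐ (B ∖ a)
∖-cong e = mk≐ (λ c (r , n) → ≐-to e c r , n) (λ c (r , n) → ≐-from e c r , n)

∪-comm : ∀ {A B} → (A ∪ B) ≐ (B ∪ A)
∪-comm = mk≐ (λ _ → [ inj₂ , inj₁ ]) (λ _ → [ inj₂ , inj₁ ])

∪-assoc : ∀ {A B C} → ((A ∪ B) ∪ C) ≐ (A ∪ (B ∪ C))
∪-assoc =
  mk≐ (λ _ → [ [ inj₁ , (λ r → inj₂ (inj₁ r)) ] , (λ r → inj₂ (inj₂ r)) ])
      (λ _ → [ (λ r → inj₁ (inj₁ r)) , [ (λ r → inj₁ (inj₂ r)) , inj₂ ] ])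

∪-identityʳ : ∀ {A} → (A ∪ ∅) ≐ A
∪-identityʳ = mk≐ (λ _ → [ (λ r → r) , (λ ()) ]) (λ _ → inj₁)

∅-∖ : ∀ {a} → (∅ ∖ a) ≐ ∅
∅-∖ = mk≐ (λ _ → proj₁) (λ _ ())

∖-comm : ∀ {A a b} → ((A ∖ a) ∖ b) ≐ ((A ∖ b) ∖ a)
∖-comm = mk≐ (λ _ ((r , na) , nb) → (r , nb) , na)
             (λ _ ((r , nb) , na) → (r , na) , nb)

∖-distrib-∪ : ∀ {A B a} → ((A ∪ B) ∖ a) ≐ ((A ∖ a) ∪ (B ∖ a))
∖-distrib-∪ =
  mk≐ (λ _ (r , n) → [ (λ r₁ → inj₁ (r₁ , n)) , (λ r₂ → inj₂ (r₂ , n)) ] r)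
      (λ _ → [ (λ (r₁ , n) → inj₁ r₁ , n) , (λ (r₂ , n) → inj₂ r₂ , n) ])

⊢-resp-≐ : ∀ {ρ σ P} → ρ ⊢ P → ρ ≐ σ → σ ⊢ P
⊢-resp-≐ (t-zero e)          s = t-zero (≐-trans (≐-sym s) e)
⊢-resp-≐ (t-par d₁ d₂ e)     s = t-par d₁ d₂ (≐-trans (≐-sym s) e)
⊢-resp-≐ (t-ν d na)          s = t-ν (⊢-resp-≐ d s) (λ r → na (≐-from s _ r))
⊢-resp-≐ (t-auth d e)        s = t-auth d (≐-trans (≐-sym s) e)
⊢-resp-≐ (t-out d e)         s = t-out d (≐-trans (≐-sym s) e)
⊢-resp-≐ (t-inp d nx e)      s = t-inp d nx (≐-trans (≐-sym s) e)
⊢-resp-≐ (t-sauth d nb e)    s = t-sauth d nb (≐-trans (≐-sym s) e)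
⊢-resp-≐ (t-rauth d e)       s = t-rauth d (≐-trans (≐-sym s) e)

-- Every name in the typing of P is free in P.  This is what makes the
-- side condition a ∉ fn P of scope extrusion, and the freshness condition
-- of α-conversion, sufficient for the typing side conditions.
⊢⇒fn : ∀ {ρ P x} → ρ ⊢ P → ρ x → fn P x
⊢⇒fn {x = x} (t-zero e) r = ≐-to e x r
⊢⇒fn {x = x} (t-par d₁ d₂ e) r =
  [ (λ r₁ → inj₁ (⊢⇒fn d₁ r₁)) , (λ r₂ → inj₂ (⊢⇒fn d₂ r₂)) ] (≐-to e x r)
⊢⇒fn {ρ} (t-ν d na) r = ⊢⇒fn d r , λ x≡a → na (subst ρ x≡a r)
⊢⇒fn {x = x} (t-auth d e) r = inj₂ (⊢⇒fn d (proj₁ (≐-to e x r)))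
⊢⇒fn {x = x} (t-out d e) r =
  [ (λ r′ → inj₂ (⊢⇒fn d r′)) , (λ x≡a → inj₁ (inj₁ x≡a)) ] (≐-to e x r)
⊢⇒fn {x = x} (t-inp {ρ' = ρ′} d nx e) r =
  [ (λ r′ → inj₂ (⊢⇒fn d r′ , λ x≡y → nx (subst ρ′ x≡y r′))) , inj₁ ]
    (≐-to e x r)
⊢⇒fn {x = x} (t-sauth d nb e) r =
  [ [ (λ r′ → inj₂ (⊢⇒fn d r′)) , (λ x≡a → inj₁ (inj₁ x≡a)) ]
  , (λ x≡b → inj₁ (inj₂ x≡b)) ] (≐-to e x r)
⊢⇒fn {x = x} (t-rauth d e) r =
  [ (λ (r′ , _) → inj₂ (⊢⇒fn d r′)) , (λ x≡a → inj₁ (inj₁ x≡a)) ]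
    (≐-to e x r)

swapN-a : ∀ a b → swapN a b a ≡ b
swapN-a a b with a ≟ a
... | yes _  = refl
... | no a≢a = ⊥-elim (a≢a refl)

swapN-b : ∀ a b → swapN a b b ≡ a
swapN-b a b with b ≟ a
... | yes b≡a = b≡a
... | no _ with b ≟ b
...   | yes _  = refl
...   | no b≢b = ⊥-elim (b≢b refl)

swapN-other : ∀ a b c → ¬ c ≡ a → ¬ c ≡ b → swapN a b c ≡ c
swapN-other a b c c≢a c≢b with c ≟ a
... | yes c≡a = ⊥-elim (c≢a c≡a)
... | no _ with c ≟ b
...   | yes c≡b = ⊥-elim (c≢b c≡b)
...   | no _    = refl

swapN-involutive : ∀ a b c → swapN a b (swapN a b c) ≡ c
swapN-involutive a b c = by-cases (c ≟ a) (c ≟ b)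
  where
  open ≡-Reasoning
  s : Name → Name
  s = swapN a b
  by-cases : Dec (c ≡ a) → Dec (c ≡ b) → s (s c) ≡ c
  by-cases (yes c≡a) _ = begin
    s (s c)  ≡⟨ cong (λ x → s (s x)) c≡a ⟩
    s (s a)  ≡⟨ cong s (swapN-a a b) ⟩
    s b      ≡⟨ swapN-b a b ⟩
    a        ≡⟨ sym c≡a ⟩
    c        ∎
  by-cases (no _) (yes c≡b) = begin
    s (s c)  ≡⟨ cong (λ x → s (s x)) c≡b ⟩
    s (s b)  ≡⟨ cong s (swapN-b a b) ⟩
    s a      ≡⟨ swapN-a a b ⟩
    b        ≡⟨ sym c≡b ⟩
    c        ∎
  by-cases (no c≢a) (no c≢b) =
    trans (cong s (swapN-other a b c c≢a c≢b)) (swapN-other a b c c≢a c≢b)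

swapN-transpose : ∀ a b c d → swapN a b c ≡ d → c ≡ swapN a b d
swapN-transpose a b c d e = trans (sym (swapN-involutive a b c)) (cong (swapN a b) e)

swapN-transpose⁻¹ : ∀ a b c d → c ≡ swapN a b d → swapN a b c ≡ d
swapN-transpose⁻¹ a b c d e = sym (swapN-transpose a b d c (sym e))

swapα-involutive : ∀ a b α → swapα a b (swapα a b α) ≡ α
swapα-involutive a b (out c d)   = cong₂ out   (swapN-involutive a b c) (swapN-involutive a b d)
swapα-involutive a b (inp c d)   = cong₂ inp   (swapN-involutive a b c) (swapN-involutive a b d)
swapα-involutive a b (sauth c d) = cong₂ sauth (swapN-involutive a b c) (swapN-involutive a b d)
swapα-involutive a b (rauth c d) = cong₂ rauth (swapN-involutive a b c) (swapN-involutive a b d)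

swap-involutive : ∀ a b P → swap a b (swap a b P) ≡ P
swap-involutive a b 𝟘        = refl
swap-involutive a b (P ∥ Q)  = cong₂ _∥_  (swap-involutive a b P) (swap-involutive a b Q)
swap-involutive a b (ν c P)  = cong₂ ν    (swapN-involutive a b c) (swap-involutive a b P)
swap-involutive a b (auth c P) = cong₂ auth (swapN-involutive a b c) (swap-involutive a b P)
swap-involutive a b (α ∙ P)  = cong₂ _∙_  (swapα-involutive a b α) (swap-involutive a b P)

-- The image of a name set under the transposition of a and b (which is
-- also its preimage, the transposition being an involution).
swapSet : Name → Name → NameSet → NameSet
swapSet a b A c = A (swapN a b c)

module _ (a b : Name) where

  swapSet-cong : ∀ {A B} → A ≐ B → swapSet a b A ≐ swapSet a b B
  swapSet-cong e c = e (swapN a b c)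

  swapSet-∉ : ∀ A {x} → ¬ A x → ¬ swapSet a b A (swapN a b x)
  swapSet-∉ A {x} nx r = nx (subst A (swapN-involutive a b x) r)

  swapSet-⁅⁆ : ∀ {x} → swapSet a b ⁅ x ⁆ ≐ ⁅ swapN a b x ⁆
  swapSet-⁅⁆ {x} = mk≐ (λ c → swapN-transpose a b c x) (λ c → swapN-transpose⁻¹ a b c x)

  swapSet-∖ : ∀ A {x} → swapSet a b (A ∖ x) ≐ (swapSet a b A ∖ swapN a b x)
  swapSet-∖ _ {x} =
    mk≐ (λ c (r , n) → r , λ e → n (swapN-transpose⁻¹ a b c x e))
        (λ c (r , n) → r , λ e → n (swapN-transpose a b c x e))

  swapSet-fresh : ∀ {A} → ¬ A a → ¬ A b → swapSet a b A ≐ A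
  swapSet-fresh {A} na nb = mk≐
    (λ c r → subst A (trans (sym (fixes r)) (swapN-involutive a b c)) r)
    (λ c r → subst A (sym (fixes r)) r)
    where
    fixes : ∀ {c} → A c → swapN a b c ≡ c
    fixes {c} r =
      swapN-other a b c (λ c≡a → na (subst A c≡a r)) (λ c≡b → nb (subst A c≡b r))

  ⊢-equivariant : ∀ {ρ P} → ρ ⊢ P → swapSet a b ρ ⊢ swap a b P
  ⊢-equivariant (t-zero e) = t-zero (swapSet-cong e)
  ⊢-equivariant (t-par d₁ d₂ e) =
    t-par (⊢-equivariant d₁) (⊢-equivariant d₂) (swapSet-cong e)
  ⊢-equivariant {ρ} (t-ν d na) = t-ν (⊢-equivariant d) (swapSet-∉ ρ na)
  ⊢-equivariant (t-auth {ρ' = ρ′} d e) =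
    t-auth (⊢-equivariant d) (≐-trans (swapSet-cong e) (swapSet-∖ ρ′))
  ⊢-equivariant (t-out d e) =
    t-out (⊢-equivariant d) (≐-trans (swapSet-cong e) (∪-cong ≐-refl swapSet-⁅⁆))
  ⊢-equivariant (t-inp {ρ' = ρ′} d nx e) =
    t-inp (⊢-equivariant d) (swapSet-∉ ρ′ nx)
          (≐-trans (swapSet-cong e) (∪-cong ≐-refl swapSet-⁅⁆))
  ⊢-equivariant (t-sauth {ρ' = ρ′} d nb e) =
    t-sauth (⊢-equivariant d) (swapSet-∉ ρ′ nb)
            (≐-trans (swapSet-cong e) (∪-cong (∪-cong ≐-refl swapSet-⁅⁆) swapSet-⁅⁆))
  ⊢-equivariant (t-rauth {ρ' = ρ′} d e) =
    t-rauth (⊢-equivariant d) (≐-trans (swapSet-cong e) (∪-cong (swapSet-∖ ρ′) swapSet-⁅⁆))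

  rename-fresh : ∀ {ρ P} → ¬ ρ a → ¬ ρ b → ρ ⊢ P → ρ ⊢ swap a b P
  rename-fresh na nb d = ⊢-resp-≐ (⊢-equivariant d) (swapSet-fresh na nb)

bound-fresh : ∀ {ρ a b P} → ¬ fn (ν a P) b → ρ ⊢ P → ¬ ρ a → ¬ ρ b
bound-fresh {a = a} {b} nf d na r with b ≟ a
... | yes refl = na r
... | no b≢a   = nf (⊢⇒fn d r , b≢a)

-- Renaming the binder preserves the typing of the body and the binder's
-- absence from it (the premises of t-ν and t-inp).
α-rename : ∀ {ρ a b P} → ¬ fn (ν a P) b →
           ρ ⊢ P × ¬ ρ a → ρ ⊢ swap a b P × ¬ ρ b
α-rename {ρ} {a} {b} nf (d , na) = rename-fresh a b na nb d , nb
  where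
  nb : ¬ ρ b
  nb = bound-fresh nf d na

-- For the converse, the freshness of a follows by applying bound-fresh
-- to the swapped typing swapSet a b ρ ⊢ P.
α-rename⁻¹ : ∀ {ρ a b P} → ¬ fn (ν a P) b →
             ρ ⊢ swap a b P × ¬ ρ b → ρ ⊢ P × ¬ ρ a
α-rename⁻¹ {ρ} {a} {b} {P} nf (d , nb) =
  subst (ρ ⊢_) (swap-involutive a b P) (rename-fresh a b na nb d) , na
  where
  swapped : swapSet a b ρ ⊢ P
  swapped = subst (swapSet a b ρ ⊢_) (swap-involutive a b P) (⊢-equivariant a b d)
  na : ¬ ρ a
  na r = bound-fresh nf swapped (λ r′ → nb (subst ρ (swapN-a a b) r′))
                     (subst ρ (sym (swapN-b a b)) r)

infix 4 _⊑⊢_ _≈⊢_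

_⊑⊢_ : Proc → Proc → Set₁
P ⊑⊢ Q = ∀ {ρ} → ρ ⊢ P → ρ ⊢ Q

_≈⊢_ : Proc → Proc → Set₁
P ≈⊢ Q = (P ⊑⊢ Q) × (Q ⊑⊢ P)

≈⊢-sym : ∀ {P Q} → P ≈⊢ Q → Q ≈⊢ P
≈⊢-sym (f , g) = g , f

≈⊢-trans : ∀ {P Q R} → P ≈⊢ Q → Q ≈⊢ R → P ≈⊢ R
≈⊢-trans (f₁ , g₁) (f₂ , g₂) = (λ d → f₂ (f₁ d)) , (λ d → g₁ (g₂ d))

-- Congruence: each typing rule has the typing of the subprocesses as its
-- only premise about them.

par-cong : ∀ {P P′ Q Q′} → P ≈⊢ P′ → Q ≈⊢ Q′ → P ∥ Q ≈⊢ P′ ∥ Q′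
par-cong (f₁ , g₁) (f₂ , g₂) =
  (λ { (t-par d₁ d₂ e) → t-par (f₁ d₁) (f₂ d₂) e }) ,
  (λ { (t-par d₁ d₂ e) → t-par (g₁ d₁) (g₂ d₂) e })

ν-cong : ∀ {a P P′} → P ≈⊢ P′ → ν a P ≈⊢ ν a P′
ν-cong (f , g) = (λ { (t-ν d n) → t-ν (f d) n }) , (λ { (t-ν d n) → t-ν (g d) n })

auth-cong : ∀ {a P P′} → P ≈⊢ P′ → auth a P ≈⊢ auth a P′
auth-cong (f , g) =
  (λ { (t-auth d e) → t-auth (f d) e }) , (λ { (t-auth d e) → t-auth (g d) e })

prefix-cong : ∀ {α P P′} → P ≈⊢ P′ → α ∙ P ≈⊢ α ∙ P′
prefix-cong (f , g) = prefix-mono f , prefix-mono g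
  where
  prefix-mono : ∀ {α P Q} → P ⊑⊢ Q → α ∙ P ⊑⊢ α ∙ Q
  prefix-mono f (t-out d e)     = t-out (f d) e
  prefix-mono f (t-inp d n e)   = t-inp (f d) n e
  prefix-mono f (t-sauth d n e) = t-sauth (f d) n e
  prefix-mono f (t-rauth d e)   = t-rauth (f d) e

-- The axioms of structural congruence.  For the symmetric axioms one
-- direction suffices, the other being an instance of it.

par-unit-≈ : ∀ {P} → P ∥ 𝟘 ≈⊢ P
par-unit-≈ =
  (λ { (t-par d (t-zero e₀) e) →
         ⊢-resp-≐ d (≐-sym (≐-trans e (≐-trans (∪-cong ≐-refl e₀) ∪-identityʳ))) }) ,
  (λ d → t-par d (t-zero ≐-refl) (≐-sym ∪-identityʳ))

par-comm-⊑ : ∀ {P Q} → P ∥ Q ⊑⊢ Q ∥ P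
par-comm-⊑ (t-par d₁ d₂ e) = t-par d₂ d₁ (≐-trans e ∪-comm)

par-assoc-≈ : ∀ {P Q R} → (P ∥ Q) ∥ R ≈⊢ P ∥ (Q ∥ R)
par-assoc-≈ =
  (λ { (t-par (t-par d₁ d₂ e₁₂) d₃ e) →
         t-par d₁ (t-par d₂ d₃ ≐-refl) (≐-trans e (≐-trans (∪-cong e₁₂ ≐-refl) ∪-assoc)) }) ,
  (λ { (t-par d₁ (t-par d₂ d₃ e₂₃) e) →
         t-par (t-par d₁ d₂ ≐-refl) d₃
               (≐-trans e (≐-trans (∪-cong ≐-refl e₂₃) (≐-sym ∪-assoc))) })

ν-zero-≈ : ∀ {a} → ν a 𝟘 ≈⊢ 𝟘
ν-zero-≈ {a} =
  (λ { (t-ν (t-zero e) _) → t-zero e }) ,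
  (λ { (t-zero e) → t-ν (t-zero e) (≐-to e a) })

ν-swap-⊑ : ∀ {a b P} → ν a (ν b P) ⊑⊢ ν b (ν a P)
ν-swap-⊑ (t-ν (t-ν d nb) na) = t-ν (t-ν d na) nb

ν-extr-≈ : ∀ {a P Q} → ¬ fn P a → P ∥ ν a Q ≈⊢ ν a (P ∥ Q)
ν-extr-≈ {a} nf =
  (λ { (t-par d₁ (t-ν d₂ na) e) →
         t-ν (t-par d₁ d₂ e) (λ r → [ (λ r₁ → nf (⊢⇒fn d₁ r₁)) , na ] (≐-to e a r)) }) ,
  (λ { (t-ν (t-par d₁ d₂ e) na) →
         t-par d₁ (t-ν d₂ (λ r₂ → na (≐-from e a (inj₂ r₂)))) e })

α-ν-≈ : ∀ {a b P} → ¬ fn (ν a P) b → ν a P ≈⊢ ν b (swap a b P)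
α-ν-≈ nf =
  (λ { (t-ν d na) → let (d′ , nb) = α-rename nf (d , na) in t-ν d′ nb }) ,
  (λ { (t-ν d nb) → let (d′ , na) = α-rename⁻¹ nf (d , nb) in t-ν d′ na })

α-inp-≈ : ∀ {c x y P} → ¬ fn (ν x P) y → inp c x ∙ P ≈⊢ inp c y ∙ swap x y P
α-inp-≈ nf =
  (λ { (t-inp d nx e) → let (d′ , ny) = α-rename nf (d , nx) in t-inp d′ ny e }) ,
  (λ { (t-inp d ny e) → let (d′ , nx) = α-rename⁻¹ nf (d , ny) in t-inp d′ nx e })

auth-swap-⊑ : ∀ {a b P} → auth a (auth b P) ⊑⊢ auth b (auth a P)
auth-swap-⊑ (t-auth (t-auth d e₁) e) =
  t-auth (t-auth d ≐-refl) (≐-trans e (≐-trans (∖-cong e₁) ∖-comm))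

auth-zero-≈ : ∀ {a} → auth a 𝟘 ≈⊢ 𝟘
auth-zero-≈ =
  (λ { (t-auth (t-zero e₀) e) → t-zero (≐-trans e (≐-trans (∖-cong e₀) ∅-∖)) }) ,
  (λ { (t-zero e) → t-auth (t-zero ≐-refl) (≐-trans e (≐-sym ∅-∖)) })

auth-par-≈ : ∀ {a P Q} → auth a (P ∥ Q) ≈⊢ auth a P ∥ auth a Q
auth-par-≈ =
  (λ { (t-auth (t-par d₁ d₂ e₁₂) e) →
         t-par (t-auth d₁ ≐-refl) (t-auth d₂ ≐-refl)
               (≐-trans e (≐-trans (∖-cong e₁₂) ∖-distrib-∪)) }) ,
  (λ { (t-par (t-auth d₁ e₁) (t-auth d₂ e₂) e) →
         t-auth (t-par d₁ d₂ ≐-refl)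
                (≐-trans e (≐-trans (∪-cong e₁ e₂) (≐-sym ∖-distrib-∪))) })

auth-ν-≈ : ∀ {a b P} → ¬ a ≡ b → auth a (ν b P) ≈⊢ ν b (auth a P)
auth-ν-≈ {b = b} a≢b =
  (λ { (t-auth (t-ν d nb) e) → t-ν (t-auth d e) (λ r → nb (proj₁ (≐-to e b r))) }) ,
  (λ { (t-ν (t-auth d e) nb) →
         t-auth (t-ν d (λ r → nb (≐-from e b (r , λ b≡a → a≢b (sym b≡a))))) e })

≅⇒≈⊢ : ∀ {P Q} → P ≅ Q → P ≈⊢ Q
≅⇒≈⊢ ≅-refl          = (λ d → d) , (λ d → d)
≅⇒≈⊢ (≅-sym p)       = ≈⊢-sym (≅⇒≈⊢ p)
≅⇒≈⊢ (≅-trans p q)   = ≈⊢-trans (≅⇒≈⊢ p) (≅⇒≈⊢ q)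
≅⇒≈⊢ (≅-par p q)     = par-cong (≅⇒≈⊢ p) (≅⇒≈⊢ q)
≅⇒≈⊢ (≅-ν p)         = ν-cong (≅⇒≈⊢ p)
≅⇒≈⊢ (≅-auth p)      = auth-cong (≅⇒≈⊢ p)
≅⇒≈⊢ (≅-pre p)       = prefix-cong (≅⇒≈⊢ p)
≅⇒≈⊢ par-unit        = par-unit-≈
≅⇒≈⊢ par-comm        = par-comm-⊑ , par-comm-⊑
≅⇒≈⊢ par-assoc       = par-assoc-≈
≅⇒≈⊢ ν-zero          = ν-zero-≈
≅⇒≈⊢ ν-swap          = ν-swap-⊑ , ν-swap-⊑
≅⇒≈⊢ (ν-extr nf)     = ν-extr-≈ nf
≅⇒≈⊢ (α-ν nf)        = α-ν-≈ nf
≅⇒≈⊢ (α-inp nf)      = α-inp-≈ nf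
≅⇒≈⊢ auth-swap       = auth-swap-⊑ , auth-swap-⊑
≅⇒≈⊢ auth-zero       = auth-zero-≈
≅⇒≈⊢ auth-par        = auth-par-≈
≅⇒≈⊢ (auth-ν a≢b)    = auth-ν-≈ a≢b

lemma2 : (ρ : NameSet) (P Q : Proc) → ρ ⊢ P → P ≅ Q → ρ ⊢ Q
lemma2 ρ P Q d p = proj₁ (≅⇒≈⊢ p) d
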